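{- The category $S5_{\Box\Diamond triv}$ is a preorder. Every modality is isomorphic in it to exactly one of $\Box$, the empty modality $\emptyset$, and $\Diamond$. Among these three, the only arrows are the identities and the (unique) arrows $\Box \to \emptyset$ (namely $\varepsilon^\Box_\emptyset$), $\emptyset \to \Diamond$ (namely $\varepsilon^\Diamond_\emptyset$), and their composite $\Box \to \Diamond$.
   Context: A modality is a finite (possibly empty) word over $\{\Box, \Diamond\}$, and $MA$ denotes prefixing $M \in \{\Box, \Diamond\}$ to $A$. The category $S5_{\Box\Diamond}$ has the modalities as objects. Its primitive arrow terms are: - $\mathbf{1}_A : A \vdash A$; - $\varepsilon^\Box_A : \Box A \vdash A$ and $\varepsilon^\Diamond_A : A \vdash \Diamond A$; - $\delta^{\Box\Box}_A : \Box A \vdash \Box\Box A$ and $\delta^{\Box\Diamond}_A : \Diamond A \vdash \Box\Diamond A$; - $\delta^{\Diamond\Diamond}_A : \Diamond\Diamond A \vdash \Diamond A$ and $\delta^{\Diamond\Box}_A : \Diamond\Box A \vdash \Box A$. For $M \in \{\Box, \Diamond\}$, $\delta^{\Box M}_A : MA \vdash \Box MA$ and $\delta^{\Diamond M}_A : \Diamond MA \vdash MA$. Arrow terms are closed under composition and under $f : A \vdash B \mapsto Mf : MA \vdash MB$. Arrows are arrow terms modulo the smallest congruence on same-typed terms containing all instances of the following equations: - the categorial equations $f \circ \mathbf{1}_A = \mathbf{1}_B \circ f = f$ and $h \circ (g \circ f) = (h \circ g) \circ f$; - the functorial equations $M\mathbf{1}_A = \mathbf{1}_{MA}$ and $M(g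 \circ f) = Mg \circ Mf$; - naturality: $\varepsilon^\Box_B \circ \Box f = f \circ \varepsilon^\Box_A$, $\Diamond f \circ \varepsilon^\Diamond_A = \varepsilon^\Diamond_B \circ f$, $\Box Mf \circ \delta^{\Box M}_A = \delta^{\Box M}_B \circ Mf$, and $\delta^{\Diamond M}_B \circ \Diamond Mf = Mf \circ \delta^{\Diamond M}_A$ (for $f : A \vdash B$); - $\Box\delta^{\Box M}_A \circ \delta^{\Box M}_A = \delta^{\Box\Box}_{MA} \circ \delta^{\Box M}_A$ and $\delta^{\Diamond M}_A \circ \Diamond\delta^{\Diamond M}_A = \delta^{\Diamond M}_A \circ \delta^{\Diamond\Diamond}_{MA}$; - $\varepsilon^\Box_{MA} \circ \delta^{\Box M}_A = \mathbf{1}_{MA}$ and $\delta^{\Diamond M}_A \circ \varepsilon^\Diamond_{MA} = \mathbf{1}_{MA}$; - $\Box\varepsilon^\Box_A \circ \delta^{\Box\Box}_A = \mathbf{1}_{\Box A}$ and $\delta^{\Diamond\Diamond}_A \circ \Diamond\varepsilon^\Diamond_A = \mathbf{1}_{\Diamond A}$; - $\Box\delta^{\Diamond M}_A \circ \delta^{\Box\Diamond}_{MA} = \delta^{\Box M}_A \circ \delta^{\Diamond M}_A$ and $\delta^{\Diamond\Box}_{MA} \circ \Diamond\delta^{\Box M}_A = \delta^{\Box M}_A \circ \delta^{\Diamond M}_A$. The six preordering equations of $S5_{\Box\Diamond}$ are, for all $A$: 1. $\Box\varepsilon^\Box_A = \varepsilon^\Box_{\Box A}$; 2. $\Box\varepsilon^\Diamond_A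 = \delta^{\Box\Diamond}_A \circ \varepsilon^\Diamond_A \circ \varepsilon^\Box_A$; 3. $\Box\varepsilon^\Diamond_{\Diamond A} \circ \delta^{\Box\Diamond}_A \circ \varepsilon^\Diamond_A = \delta^{\Box\Diamond}_{\Diamond A} \circ \varepsilon^\Diamond_{\Diamond A} \circ \varepsilon^\Diamond_A$; 4. $\varepsilon^\Box_A \circ \varepsilon^\Box_{\Box A} \circ \delta^{\Diamond\Box}_{\Box A} = \varepsilon^\Box_A \circ \delta^{\Diamond\Box}_A \circ \Diamond\varepsilon^\Box_{\Box A}$; 5. $\varepsilon^\Diamond_A \circ \varepsilon^\Box_A \circ \delta^{\Diamond\Box}_A = \Diamond\varepsilon^\Box_A$; 6. $\varepsilon^\Diamond_{\Diamond A} = \Diamond\varepsilon^\Diamond_A$. The category $S5_{\Box\Diamond triv}$ is defined like $S5_{\Box\Diamond}$ but with one of these six preordering equations added as an additional equation (for all $A$). Which one is added does not affect the claim. -}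

module Defs where

open import Data.List using (List; []; _∷_)
open import Data.Fin using (Fin; zero; suc)
open import Data.Product using (Σ; _×_; _,_)
open import Relation.Binary.PropositionalEquality using (_≡_)

data Op : Set where
  □ ◇ : Op

-- A modality: a finite word over {□, ◇}.  M ∷ A is "MA" (prefixing).
Modality : Set
Modality = List Op

-- Arrow terms of S5_{□◇}.  δB M A is δ^{□M}_A : MA ⊢ □MA,
-- δD M A is δ^{◇M}_A : ◇MA ⊢ MA (covering δ^{□□}, δ^{□◇}, δ^{◇◇}, δ^{◇□}).
infixr 9 _∘_
data Term : Modality → Modality → Set where
  𝟏    : (A : Modality) → Term A A
  εB   : (A : Modality) → Term (□ ∷ A) A
  εD   : (A : Modality) → Term A (◇ ∷ A)
  δB   : (M : Op) (A : Modality) → Term (M ∷ A) (□ ∷ M ∷ A)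
  δD   : (M : Op) (A : Modality) → Term (◇ ∷ M ∷ A) (M ∷ A)
  _∘_  : {A B C : Modality} → Term B C → Term A B → Term A C
  fmap : (M : Op) {A B : Modality} → Term A B → Term (M ∷ A) (M ∷ B)

-- The equality of S5_{□◇triv}, where the extra preordering equation
-- added is the one numbered (i+1) for i : Fin 6.
infix 4 _⊢_≈_
data _⊢_≈_ (i : Fin 6) : {A B : Modality} → Term A B → Term A B → Set where
  ≈-refl  : ∀ {A B} {f : Term A B} → i ⊢ f ≈ f
  ≈-sym   : ∀ {A B} {f g : Term A B} → i ⊢ f ≈ g → i ⊢ g ≈ f
  ≈-trans : ∀ {A B} {f g h : Term A B} → i ⊢ f ≈ g → i ⊢ g ≈ h → i ⊢ f ≈ h
  ∘-cong  : ∀ {A B C} {f f' : Term A B} {g g' : Term B C} →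
            i ⊢ f ≈ f' → i ⊢ g ≈ g' → i ⊢ g ∘ f ≈ g' ∘ f'
  fmap-cong : ∀ M {A B} {f f' : Term A B} → i ⊢ f ≈ f' → i ⊢ fmap M f ≈ fmap M f'
  idʳ   : ∀ {A B} (f : Term A B) → i ⊢ f ∘ 𝟏 A ≈ f
  idˡ   : ∀ {A B} (f : Term A B) → i ⊢ 𝟏 B ∘ f ≈ f
  assoc : ∀ {A B C D} (f : Term A B) (g : Term B C) (h : Term C D) →
          i ⊢ h ∘ (g ∘ f) ≈ (h ∘ g) ∘ f
  fmap-id : ∀ M A → i ⊢ fmap M (𝟏 A) ≈ 𝟏 (M ∷ A)
  fmap-∘  : ∀ M {A B C} (f : Term A B) (g : Term B C) →
            i ⊢ fmap M (g ∘ f) ≈ fmap M g ∘ fmap M f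
  nat-εB : ∀ {A B} (f : Term A B) → i ⊢ εB B ∘ fmap □ f ≈ f ∘ εB A
  nat-εD : ∀ {A B} (f : Term A B) → i ⊢ fmap ◇ f ∘ εD A ≈ εD B ∘ f
  nat-δB : ∀ M {A B} (f : Term A B) →
           i ⊢ fmap □ (fmap M f) ∘ δB M A ≈ δB M B ∘ fmap M f
  nat-δD : ∀ M {A B} (f : Term A B) →
           i ⊢ δD M B ∘ fmap ◇ (fmap M f) ≈ fmap M f ∘ δD M A
  δB-δB : ∀ M A → i ⊢ fmap □ (δB M A) ∘ δB M A ≈ δB □ (M ∷ A) ∘ δB M A
  δD-δD : ∀ M A → i ⊢ δD M A ∘ fmap ◇ (δD M A) ≈ δD M A ∘ δD ◇ (M ∷ A)
  εB-δB : ∀ M A → i ⊢ εB (M ∷ A) ∘ δB M A ≈ 𝟏 (M ∷ A)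
  δD-εD : ∀ M A → i ⊢ δD M A ∘ εD (M ∷ A) ≈ 𝟏 (M ∷ A)
  □εB-δB : ∀ A → i ⊢ fmap □ (εB A) ∘ δB □ A ≈ 𝟏 (□ ∷ A)
  δD-◇εD : ∀ A → i ⊢ δD ◇ A ∘ fmap ◇ (εD A) ≈ 𝟏 (◇ ∷ A)
  □δD-δB : ∀ M A → i ⊢ fmap □ (δD M A) ∘ δB ◇ (M ∷ A) ≈ δB M A ∘ δD M A
  δD-◇δB : ∀ M A → i ⊢ δD □ (M ∷ A) ∘ fmap ◇ (δB M A) ≈ δB M A ∘ δD M A
  pe1 : ∀ A → i ≡ zero →
        i ⊢ fmap □ (εB A) ≈ εB (□ ∷ A)
  pe2 : ∀ A → i ≡ suc zero →
        i ⊢ fmap □ (εD A) ≈ δB ◇ A ∘ εD A ∘ εB A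
  pe3 : ∀ A → i ≡ suc (suc zero) →
        i ⊢ fmap □ (εD (◇ ∷ A)) ∘ δB ◇ A ∘ εD A ≈ δB ◇ (◇ ∷ A) ∘ εD (◇ ∷ A) ∘ εD A
  pe4 : ∀ A → i ≡ suc (suc (suc zero)) →
        i ⊢ εB A ∘ εB (□ ∷ A) ∘ δD □ (□ ∷ A) ≈ εB A ∘ δD □ A ∘ fmap ◇ (εB (□ ∷ A))
  pe5 : ∀ A → i ≡ suc (suc (suc (suc zero))) →
        i ⊢ εD A ∘ εB A ∘ δD □ A ≈ fmap ◇ (εB A)
  pe6 : ∀ A → i ≡ suc (suc (suc (suc (suc zero)))) →
        i ⊢ εD (◇ ∷ A) ≈ fmap ◇ (εD A)

Iso : Fin 6 → Modality → Modality → Set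
Iso i A B = Σ (Term A B) λ f → Σ (Term B A) λ g →
  (i ⊢ g ∘ f ≈ 𝟏 A) × (i ⊢ f ∘ g ≈ 𝟏 B)

canon : Fin 3 → Modality
canon zero = □ ∷ []
canon (suc zero) = []
canon (suc (suc zero)) = ◇ ∷ []

-- Each of the six preordering equations forces δ to be inverse to ε, i.e. □M ≅ M ≅ ◇M for
-- every nonempty modality M.  For equations 3 and 4, and for passing between the □ and ◇ halves,
-- the tool is the adjunction ◇ ⊣ □ with unit δ^{□◇} ∘ ε^◇ and counit ε^□ ∘ δ^{◇□}, whose
-- transposition is injective.  Hence every modality is isomorphic to □, ∅ or ◇ according to its
-- innermost operator.  Conjugating by these isomorphisms sends every arrow term A → B to an arrow
-- between the canonical forms of A and B in the chain □ → ∅ → ◇, which has at most one arrow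
-- between any two objects; so any two parallel arrows are equal.
module Submission where

open import Defs
open import Data.List using ([]; _∷_)
open import Data.Fin using (Fin; zero; suc)
open import Data.Product using (Σ; _×_; _,_; proj₁; proj₂)
open import Data.Empty using (⊥)
open import Function using (case_of_)
open import Relation.Binary.PropositionalEquality using (_≡_; refl; sym; trans; subst)

□₁ : {A B : Modality} → Term A B → Term (□ ∷ A) (□ ∷ B)
□₁ = fmap □

◇₁ : {A B : Modality} → Term A B → Term (◇ ∷ A) (◇ ∷ B)
◇₁ = fmap ◇

unit : (A : Modality) → Term A (□ ∷ ◇ ∷ A)
unit A = δB ◇ A ∘ εD A

counit : (A : Modality) → Term (◇ ∷ □ ∷ A) A
counit A = εB A ∘ δD □ A

infixl 10 _♯ _♭

_♯ : {A Y : Modality} → Term (◇ ∷ A) Y → Term A (□ ∷ Y)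
_♯ {A} g = □₁ g ∘ unit A

_♭ : {A Y : Modality} → Term Y (□ ∷ A) → Term (◇ ∷ Y) A
_♭ {A} g = counit A ∘ ◇₁ g

module Equational (i : Fin 6) where

  infix 4 _≈_
  _≈_ : {A B : Modality} → Term A B → Term A B → Set
  f ≈ g = i ⊢ f ≈ g

  infix  1 begin_
  infixr 2 _≈⟨_⟩_ _≈⟨_⟨_
  infix  3 _∎

  begin_ : {A B : Modality} {f g : Term A B} → f ≈ g → f ≈ g
  begin p = p

  _≈⟨_⟩_ : {A B : Modality} (f : Term A B) {g h : Term A B} → f ≈ g → g ≈ h → f ≈ h
  f ≈⟨ p ⟩ q = ≈-trans p q

  _≈⟨_⟨_ : {A B : Modality} (f : Term A B) {g h : Term A B} → g ≈ f → g ≈ h → f ≈ h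
  f ≈⟨ p ⟨ q = ≈-trans (≈-sym p) q

  _∎ : {A B : Modality} (f : Term A B) → f ≈ f
  f ∎ = ≈-refl

  variable
    A B C D Y Z : Modality

  infixr 4 _⟩∘⟨_ refl⟩∘⟨_
  infixl 5 _⟩∘⟨refl

  _⟩∘⟨_ : {g g' : Term B C} {f f' : Term A B} → g ≈ g' → f ≈ f' → g ∘ f ≈ g' ∘ f'
  p ⟩∘⟨ q = ∘-cong q p

  refl⟩∘⟨_ : {g : Term B C} {f f' : Term A B} → f ≈ f' → g ∘ f ≈ g ∘ f'
  refl⟩∘⟨ q = ≈-refl ⟩∘⟨ q

  _⟩∘⟨refl : {g g' : Term B C} {f : Term A B} → g ≈ g' → g ∘ f ≈ g' ∘ f
  p ⟩∘⟨refl = p ⟩∘⟨ ≈-refl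

  ∘-identityˡ : {f : Term A B} → 𝟏 B ∘ f ≈ f
  ∘-identityˡ {f = f} = idˡ f

  ∘-identityʳ : {f : Term A B} → f ∘ 𝟏 A ≈ f
  ∘-identityʳ {f = f} = idʳ f

  assocˡ : {f : Term A B} {g : Term B C} {h : Term C D} → h ∘ (g ∘ f) ≈ (h ∘ g) ∘ f
  assocˡ {f = f} {g} {h} = assoc f g h

  assocʳ : {f : Term A B} {g : Term B C} {h : Term C D} → (h ∘ g) ∘ f ≈ h ∘ (g ∘ f)
  assocʳ = ≈-sym assocˡ

  cancelˡ : {f : Term C A} {g : Term A B} {h : Term B A} → h ∘ g ≈ 𝟏 A → h ∘ (g ∘ f) ≈ f
  cancelˡ p = ≈-trans assocˡ (≈-trans (p ⟩∘⟨refl) ∘-identityˡ)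

  cancelʳ : {f : Term A B} {g : Term B A} {h : Term A C} → g ∘ f ≈ 𝟏 A → (h ∘ g) ∘ f ≈ h
  cancelʳ p = ≈-trans assocʳ (≈-trans (refl⟩∘⟨ p) ∘-identityʳ)

  inverse-∘ : {f : Term A B} {g : Term B A} {h : Term B C} {k : Term C B} →
              g ∘ f ≈ 𝟏 A → k ∘ h ≈ 𝟏 B → (g ∘ k) ∘ (h ∘ f) ≈ 𝟏 A
  inverse-∘ p q = ≈-trans assocʳ (≈-trans (refl⟩∘⟨ cancelˡ q) p)

  sandwich : {k : Term A B} {f : Term B C} {g : Term C D} {x : Term A D} {y : Term B A}
             {h : Term D A} → g ∘ f ≈ x ∘ y → h ∘ x ≈ 𝟏 A → y ∘ k ≈ 𝟏 A →
             h ∘ (g ∘ (f ∘ k)) ≈ 𝟏 A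
  sandwich {k = k} {f} {g} {x} {y} {h} p q r = begin
    h ∘ (g ∘ (f ∘ k))  ≈⟨ refl⟩∘⟨ assocˡ ⟩
    h ∘ ((g ∘ f) ∘ k)  ≈⟨ refl⟩∘⟨ p ⟩∘⟨refl ⟩
    h ∘ ((x ∘ y) ∘ k)  ≈⟨ refl⟩∘⟨ assocʳ ⟩
    h ∘ (x ∘ (y ∘ k))  ≈⟨ refl⟩∘⟨ refl⟩∘⟨ r ⟩
    h ∘ (x ∘ 𝟏 _)      ≈⟨ refl⟩∘⟨ ∘-identityʳ ⟩
    h ∘ x              ≈⟨ q ⟩
    𝟏 _                ∎

  fmap-homo : ∀ M {f : Term A B} {g : Term B C} → fmap M (g ∘ f) ≈ fmap M g ∘ fmap M f
  fmap-homo M {f} {g} = fmap-∘ M f g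

  fmap-inverse : ∀ M {f : Term A B} {g : Term B A} → g ∘ f ≈ 𝟏 A →
                 fmap M g ∘ fmap M f ≈ 𝟏 (M ∷ A)
  fmap-inverse M p = ≈-trans (≈-sym (fmap-homo M)) (≈-trans (fmap-cong M p) (fmap-id M _))

  unit-natural : (f : Term A B) → □₁ (◇₁ f) ∘ unit A ≈ unit B ∘ f
  unit-natural {A} {B} f = begin
    □₁ (◇₁ f) ∘ (δB ◇ A ∘ εD A)  ≈⟨ assocˡ ⟩
    (□₁ (◇₁ f) ∘ δB ◇ A) ∘ εD A  ≈⟨ nat-δB ◇ f ⟩∘⟨refl ⟩
    (δB ◇ B ∘ ◇₁ f) ∘ εD A       ≈⟨ assocʳ ⟩
    δB ◇ B ∘ (◇₁ f ∘ εD A)       ≈⟨ refl⟩∘⟨ nat-εD f ⟩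
    δB ◇ B ∘ (εD B ∘ f)          ≈⟨ assocˡ ⟩
    unit B ∘ f                   ∎

  counit-natural : (f : Term A B) → f ∘ counit A ≈ counit B ∘ ◇₁ (□₁ f)
  counit-natural {A} {B} f = begin
    f ∘ (εB A ∘ δD □ A)            ≈⟨ assocˡ ⟩
    (f ∘ εB A) ∘ δD □ A            ≈⟨ nat-εB f ⟩∘⟨refl ⟨
    (εB B ∘ □₁ f) ∘ δD □ A         ≈⟨ assocʳ ⟩
    εB B ∘ (□₁ f ∘ δD □ A)         ≈⟨ refl⟩∘⟨ nat-δD □ f ⟨
    εB B ∘ (δD □ B ∘ ◇₁ (□₁ f))    ≈⟨ assocˡ ⟩
    counit B ∘ ◇₁ (□₁ f)           ∎

  triangle-◇ : counit (◇ ∷ A) ∘ ◇₁ (unit A) ≈ 𝟏 (◇ ∷ A)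
  triangle-◇ {A} = begin
    (εB (◇ ∷ A) ∘ δD □ (◇ ∷ A)) ∘ ◇₁ (δB ◇ A ∘ εD A)
      ≈⟨ assocʳ ⟩
    εB (◇ ∷ A) ∘ (δD □ (◇ ∷ A) ∘ ◇₁ (δB ◇ A ∘ εD A))
      ≈⟨ refl⟩∘⟨ refl⟩∘⟨ fmap-homo ◇ ⟩
    εB (◇ ∷ A) ∘ (δD □ (◇ ∷ A) ∘ (◇₁ (δB ◇ A) ∘ ◇₁ (εD A)))
      ≈⟨ refl⟩∘⟨ assocˡ ⟩
    εB (◇ ∷ A) ∘ ((δD □ (◇ ∷ A) ∘ ◇₁ (δB ◇ A)) ∘ ◇₁ (εD A))
      ≈⟨ refl⟩∘⟨ δD-◇δB ◇ A ⟩∘⟨refl ⟩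
    εB (◇ ∷ A) ∘ ((δB ◇ A ∘ δD ◇ A) ∘ ◇₁ (εD A))
      ≈⟨ refl⟩∘⟨ cancelʳ (δD-◇εD A) ⟩
    εB (◇ ∷ A) ∘ δB ◇ A
      ≈⟨ εB-δB ◇ A ⟩
    𝟏 _ ∎

  triangle-□ : □₁ (counit A) ∘ unit (□ ∷ A) ≈ 𝟏 (□ ∷ A)
  triangle-□ {A} = begin
    □₁ (εB A ∘ δD □ A) ∘ (δB ◇ (□ ∷ A) ∘ εD (□ ∷ A))
      ≈⟨ fmap-homo □ ⟩∘⟨refl ⟩
    (□₁ (εB A) ∘ □₁ (δD □ A)) ∘ (δB ◇ (□ ∷ A) ∘ εD (□ ∷ A))
      ≈⟨ assocʳ ⟩
    □₁ (εB A) ∘ (□₁ (δD □ A) ∘ (δB ◇ (□ ∷ A) ∘ εD (□ ∷ A)))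
      ≈⟨ refl⟩∘⟨ assocˡ ⟩
    □₁ (εB A) ∘ ((□₁ (δD □ A) ∘ δB ◇ (□ ∷ A)) ∘ εD (□ ∷ A))
      ≈⟨ refl⟩∘⟨ □δD-δB □ A ⟩∘⟨refl ⟩
    □₁ (εB A) ∘ ((δB □ A ∘ δD □ A) ∘ εD (□ ∷ A))
      ≈⟨ refl⟩∘⟨ cancelʳ (δD-εD □ A) ⟩
    □₁ (εB A) ∘ δB □ A
      ≈⟨ □εB-δB A ⟩
    𝟏 _ ∎

  ♯-♭ : (g : Term (◇ ∷ A) Y) → g ♯ ♭ ≈ g
  ♯-♭ {A} {Y} g = begin
    counit Y ∘ ◇₁ (□₁ g ∘ unit A)             ≈⟨ refl⟩∘⟨ fmap-homo ◇ ⟩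
    counit Y ∘ (◇₁ (□₁ g) ∘ ◇₁ (unit A))      ≈⟨ assocˡ ⟩
    (counit Y ∘ ◇₁ (□₁ g)) ∘ ◇₁ (unit A)      ≈⟨ counit-natural g ⟩∘⟨refl ⟨
    (g ∘ counit (◇ ∷ A)) ∘ ◇₁ (unit A)        ≈⟨ cancelʳ triangle-◇ ⟩
    g                                         ∎

  ♭-♯ : (g : Term Y (□ ∷ A)) → g ♭ ♯ ≈ g
  ♭-♯ {Y} {A} g = begin
    □₁ (counit A ∘ ◇₁ g) ∘ unit Y             ≈⟨ fmap-homo □ ⟩∘⟨refl ⟩
    (□₁ (counit A) ∘ □₁ (◇₁ g)) ∘ unit Y      ≈⟨ assocʳ ⟩
    □₁ (counit A) ∘ (□₁ (◇₁ g) ∘ unit Y)      ≈⟨ refl⟩∘⟨ unit-natural g ⟩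
    □₁ (counit A) ∘ (unit (□ ∷ A) ∘ g)        ≈⟨ cancelˡ triangle-□ ⟩
    g                                         ∎

  ♯-injective : {g g' : Term (◇ ∷ A) Y} → g ♯ ≈ g' ♯ → g ≈ g'
  ♯-injective {g = g} {g'} e = begin
    g          ≈⟨ ♯-♭ g ⟨
    g ♯ ♭      ≈⟨ refl⟩∘⟨ fmap-cong ◇ e ⟩
    g' ♯ ♭     ≈⟨ ♯-♭ g' ⟩
    g'         ∎

  ♭-injective : {g g' : Term Y (□ ∷ A)} → g ♭ ≈ g' ♭ → g ≈ g'
  ♭-injective {g = g} {g'} e = begin
    g          ≈⟨ ♭-♯ g ⟨
    g ♭ ♯      ≈⟨ fmap-cong □ e ⟩∘⟨refl ⟩
    g' ♭ ♯     ≈⟨ ♭-♯ g' ⟩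
    g'         ∎

  𝟏-♯ : 𝟏 (◇ ∷ A) ♯ ≈ unit A
  𝟏-♯ = ≈-trans (fmap-id □ _ ⟩∘⟨refl) ∘-identityˡ

  𝟏-♭ : 𝟏 (□ ∷ A) ♭ ≈ counit A
  𝟏-♭ = ≈-trans (refl⟩∘⟨ fmap-id ◇ _) ∘-identityʳ

  PE₁ PE₂ PE₃ PE₄ PE₅ PE₆ : Set
  PE₁ = ∀ A → □₁ (εB A) ≈ εB (□ ∷ A)
  PE₂ = ∀ A → □₁ (εD A) ≈ δB ◇ A ∘ εD A ∘ εB A
  PE₃ = ∀ A → □₁ (εD (◇ ∷ A)) ∘ δB ◇ A ∘ εD A ≈ δB ◇ (◇ ∷ A) ∘ εD (◇ ∷ A) ∘ εD A
  PE₄ = ∀ A → εB A ∘ εB (□ ∷ A) ∘ δD □ (□ ∷ A) ≈ εB A ∘ δD □ A ∘ ◇₁ (εB (□ ∷ A))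
  PE₅ = ∀ A → εD A ∘ εB A ∘ δD □ A ≈ ◇₁ (εB A)
  PE₆ = ∀ A → εD (◇ ∷ A) ≈ ◇₁ (εD A)

  □-Absorbing ◇-Absorbing □◇-Absorbing ◇□-Absorbing Absorbing : Set
  □-Absorbing = ∀ M A → δB M A ∘ εB (M ∷ A) ≈ 𝟏 (□ ∷ M ∷ A)
  ◇-Absorbing = ∀ M A → εD (M ∷ A) ∘ δD M A ≈ 𝟏 (◇ ∷ M ∷ A)
  □◇-Absorbing = ∀ A → δB ◇ A ∘ εB (◇ ∷ A) ≈ 𝟏 (□ ∷ ◇ ∷ A)
  ◇□-Absorbing = ∀ A → εD (□ ∷ A) ∘ δD □ A ≈ 𝟏 (◇ ∷ □ ∷ A)
  Absorbing = □-Absorbing × ◇-Absorbing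

  PE₁⇒□-Absorbing : PE₁ → □-Absorbing
  PE₁⇒□-Absorbing pe M A = begin
    δB M A ∘ εB (M ∷ A)              ≈⟨ nat-εB (δB M A) ⟨
    εB (□ ∷ M ∷ A) ∘ □₁ (δB M A)     ≈⟨ pe (M ∷ A) ⟩∘⟨refl ⟨
    □₁ (εB (M ∷ A)) ∘ □₁ (δB M A)    ≈⟨ fmap-inverse □ (εB-δB M A) ⟩
    𝟏 _                              ∎

  PE₆⇒◇-Absorbing : PE₆ → ◇-Absorbing
  PE₆⇒◇-Absorbing pe M A = begin
    εD (M ∷ A) ∘ δD M A              ≈⟨ nat-εD (δD M A) ⟨
    ◇₁ (δD M A) ∘ εD (◇ ∷ M ∷ A)     ≈⟨ refl⟩∘⟨ pe (M ∷ A) ⟩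
    ◇₁ (δD M A) ∘ ◇₁ (εD (M ∷ A))    ≈⟨ fmap-inverse ◇ (δD-εD M A) ⟩
    𝟏 _                              ∎

  PE₂⇒□◇-Absorbing : PE₂ → □◇-Absorbing
  PE₂⇒□◇-Absorbing pe B = begin
    δB ◇ B ∘ εB (◇ ∷ B)
      ≈⟨ refl⟩∘⟨ cancelˡ (δD-εD ◇ B) ⟨
    δB ◇ B ∘ (δD ◇ B ∘ (εD (◇ ∷ B) ∘ εB (◇ ∷ B)))
      ≈⟨ assocˡ ⟩
    (δB ◇ B ∘ δD ◇ B) ∘ (εD (◇ ∷ B) ∘ εB (◇ ∷ B))
      ≈⟨ □δD-δB ◇ B ⟩∘⟨refl ⟨
    (□₁ (δD ◇ B) ∘ δB ◇ (◇ ∷ B)) ∘ (εD (◇ ∷ B) ∘ εB (◇ ∷ B))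
      ≈⟨ assocʳ ⟩
    □₁ (δD ◇ B) ∘ (δB ◇ (◇ ∷ B) ∘ (εD (◇ ∷ B) ∘ εB (◇ ∷ B)))
      ≈⟨ refl⟩∘⟨ pe (◇ ∷ B) ⟨
    □₁ (δD ◇ B) ∘ □₁ (εD (◇ ∷ B))
      ≈⟨ fmap-inverse □ (δD-εD ◇ B) ⟩
    𝟏 _ ∎

  PE₅⇒◇□-Absorbing : PE₅ → ◇□-Absorbing
  PE₅⇒◇□-Absorbing pe B = begin
    εD (□ ∷ B) ∘ δD □ B
      ≈⟨ cancelʳ (εB-δB □ B) ⟩∘⟨refl ⟨
    ((εD (□ ∷ B) ∘ εB (□ ∷ B)) ∘ δB □ B) ∘ δD □ B
      ≈⟨ assocʳ ⟩
    (εD (□ ∷ B) ∘ εB (□ ∷ B)) ∘ (δB □ B ∘ δD □ B)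
      ≈⟨ refl⟩∘⟨ δD-◇δB □ B ⟨
    (εD (□ ∷ B) ∘ εB (□ ∷ B)) ∘ (δD □ (□ ∷ B) ∘ ◇₁ (δB □ B))
      ≈⟨ ≈-trans assocˡ (assocʳ ⟩∘⟨refl) ⟩
    (εD (□ ∷ B) ∘ εB (□ ∷ B) ∘ δD □ (□ ∷ B)) ∘ ◇₁ (δB □ B)
      ≈⟨ pe (□ ∷ B) ⟩∘⟨refl ⟩
    ◇₁ (εB (□ ∷ B)) ∘ ◇₁ (δB □ B)
      ≈⟨ fmap-inverse ◇ (εB-δB □ B) ⟩
    𝟏 _ ∎

  PE₃⇒PE₆ : PE₃ → PE₆
  PE₃⇒PE₆ pe A = ♯-injective (begin
    εD (◇ ∷ A) ♯                              ≈⟨ pe A ⟩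
    δB ◇ (◇ ∷ A) ∘ εD (◇ ∷ A) ∘ εD A          ≈⟨ assocˡ ⟩
    unit (◇ ∷ A) ∘ εD A                       ≈⟨ unit-natural (εD A) ⟨
    ◇₁ (εD A) ♯                               ∎)

  PE₄⇒PE₁ : PE₄ → PE₁
  PE₄⇒PE₁ pe A = ♭-injective (begin
    □₁ (εB A) ♭                               ≈⟨ counit-natural (εB A) ⟨
    εB A ∘ counit (□ ∷ A)                     ≈⟨ pe A ⟩
    εB A ∘ δD □ A ∘ ◇₁ (εB (□ ∷ A))           ≈⟨ assocˡ ⟩
    εB (□ ∷ A) ♭                              ∎)

  □◇-Absorbing⇒□-Absorbing : □◇-Absorbing → □-Absorbing
  □◇-Absorbing⇒□-Absorbing h M A = begin
    δB M A ∘ εB (M ∷ A)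
      ≈⟨ cancelʳ (δD-εD M A) ⟩∘⟨refl ⟨
    ((δB M A ∘ δD M A) ∘ εD (M ∷ A)) ∘ εB (M ∷ A)
      ≈⟨ assocʳ ⟩
    (δB M A ∘ δD M A) ∘ (εD (M ∷ A) ∘ εB (M ∷ A))
      ≈⟨ □δD-δB M A ⟩∘⟨ nat-εB (εD (M ∷ A)) ⟨
    (□₁ (δD M A) ∘ δB ◇ (M ∷ A)) ∘ (εB (◇ ∷ M ∷ A) ∘ □₁ (εD (M ∷ A)))
      ≈⟨ assocʳ ⟩
    □₁ (δD M A) ∘ (δB ◇ (M ∷ A) ∘ (εB (◇ ∷ M ∷ A) ∘ □₁ (εD (M ∷ A))))
      ≈⟨ refl⟩∘⟨ cancelˡ (h (M ∷ A)) ⟩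
    □₁ (δD M A) ∘ □₁ (εD (M ∷ A))
      ≈⟨ fmap-inverse □ (δD-εD M A) ⟩
    𝟏 _ ∎

  ◇□-Absorbing⇒◇-Absorbing : ◇□-Absorbing → ◇-Absorbing
  ◇□-Absorbing⇒◇-Absorbing h M A = begin
    εD (M ∷ A) ∘ δD M A
      ≈⟨ refl⟩∘⟨ cancelˡ (εB-δB M A) ⟨
    εD (M ∷ A) ∘ (εB (M ∷ A) ∘ (δB M A ∘ δD M A))
      ≈⟨ assocˡ ⟩
    (εD (M ∷ A) ∘ εB (M ∷ A)) ∘ (δB M A ∘ δD M A)
      ≈⟨ nat-εD (εB (M ∷ A)) ⟩∘⟨ δD-◇δB M A ⟨
    (◇₁ (εB (M ∷ A)) ∘ εD (□ ∷ M ∷ A)) ∘ (δD □ (M ∷ A) ∘ ◇₁ (δB M A))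
      ≈⟨ assocʳ ⟩
    ◇₁ (εB (M ∷ A)) ∘ (εD (□ ∷ M ∷ A) ∘ (δD □ (M ∷ A) ∘ ◇₁ (δB M A)))
      ≈⟨ refl⟩∘⟨ cancelˡ (h (M ∷ A)) ⟩
    ◇₁ (εB (M ∷ A)) ∘ ◇₁ (δB M A)
      ≈⟨ fmap-inverse ◇ (εB-δB M A) ⟩
    𝟏 _ ∎

  -- Both sides become f after composing with εB (◇ ∷ Y), which is invertible by hypothesis.
  □◇-Absorbing⇒δB-cross : □◇-Absorbing → (f : Term (□ ∷ Z) (◇ ∷ Y)) →
                          □₁ f ∘ δB □ Z ≈ δB ◇ Y ∘ f
  □◇-Absorbing⇒δB-cross {Z} {Y} h f = begin
    □₁ f ∘ δB □ Z                              ≈⟨ cancelˡ (h Y) ⟨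
    δB ◇ Y ∘ (εB (◇ ∷ Y) ∘ (□₁ f ∘ δB □ Z))    ≈⟨ refl⟩∘⟨ assocˡ ⟩
    δB ◇ Y ∘ ((εB (◇ ∷ Y) ∘ □₁ f) ∘ δB □ Z)    ≈⟨ refl⟩∘⟨ nat-εB f ⟩∘⟨refl ⟩
    δB ◇ Y ∘ ((f ∘ εB (□ ∷ Z)) ∘ δB □ Z)       ≈⟨ refl⟩∘⟨ cancelʳ (εB-δB □ Z) ⟩
    δB ◇ Y ∘ f                                 ∎

  ◇□-Absorbing⇒δD-cross : ◇□-Absorbing → (f : Term (□ ∷ Y) (◇ ∷ Z)) →
                          δD ◇ Z ∘ ◇₁ f ≈ f ∘ δD □ Y
  ◇□-Absorbing⇒δD-cross {Y} {Z} h f = begin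
    δD ◇ Z ∘ ◇₁ f                              ≈⟨ cancelʳ (h Y) ⟨
    ((δD ◇ Z ∘ ◇₁ f) ∘ εD (□ ∷ Y)) ∘ δD □ Y    ≈⟨ assocʳ ⟩∘⟨refl ⟩
    (δD ◇ Z ∘ (◇₁ f ∘ εD (□ ∷ Y))) ∘ δD □ Y    ≈⟨ (refl⟩∘⟨ nat-εD f) ⟩∘⟨refl ⟩
    (δD ◇ Z ∘ (εD (◇ ∷ Z) ∘ f)) ∘ δD □ Y       ≈⟨ cancelˡ (δD-εD ◇ Z) ⟩∘⟨refl ⟩
    f ∘ δD □ Y                                 ∎

  □◇-Absorbing⇒◇□-Absorbing : □◇-Absorbing → ◇□-Absorbing
  □◇-Absorbing⇒◇□-Absorbing h B = ♯-injective (begin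
    □₁ (εD (□ ∷ B) ∘ δD □ B) ∘ (δB ◇ (□ ∷ B) ∘ εD (□ ∷ B))
      ≈⟨ fmap-homo □ ⟩∘⟨refl ⟩
    (□₁ (εD (□ ∷ B)) ∘ □₁ (δD □ B)) ∘ (δB ◇ (□ ∷ B) ∘ εD (□ ∷ B))
      ≈⟨ ≈-trans assocʳ (refl⟩∘⟨ assocˡ) ⟩
    □₁ (εD (□ ∷ B)) ∘ ((□₁ (δD □ B) ∘ δB ◇ (□ ∷ B)) ∘ εD (□ ∷ B))
      ≈⟨ refl⟩∘⟨ □δD-δB □ B ⟩∘⟨refl ⟩
    □₁ (εD (□ ∷ B)) ∘ ((δB □ B ∘ δD □ B) ∘ εD (□ ∷ B))
      ≈⟨ refl⟩∘⟨ cancelʳ (δD-εD □ B) ⟩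
    □₁ (εD (□ ∷ B)) ∘ δB □ B
      ≈⟨ □◇-Absorbing⇒δB-cross h (εD (□ ∷ B)) ⟩
    unit (□ ∷ B)
      ≈⟨ 𝟏-♯ ⟨
    𝟏 _ ♯ ∎)

  ◇□-Absorbing⇒□◇-Absorbing : ◇□-Absorbing → □◇-Absorbing
  ◇□-Absorbing⇒□◇-Absorbing h B = ♭-injective (begin
    (εB (◇ ∷ B) ∘ δD □ (◇ ∷ B)) ∘ ◇₁ (δB ◇ B ∘ εB (◇ ∷ B))
      ≈⟨ refl⟩∘⟨ fmap-homo ◇ ⟩
    (εB (◇ ∷ B) ∘ δD □ (◇ ∷ B)) ∘ (◇₁ (δB ◇ B) ∘ ◇₁ (εB (◇ ∷ B)))
      ≈⟨ ≈-trans assocʳ (refl⟩∘⟨ assocˡ) ⟩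
    εB (◇ ∷ B) ∘ ((δD □ (◇ ∷ B) ∘ ◇₁ (δB ◇ B)) ∘ ◇₁ (εB (◇ ∷ B)))
      ≈⟨ refl⟩∘⟨ δD-◇δB ◇ B ⟩∘⟨refl ⟩
    εB (◇ ∷ B) ∘ ((δB ◇ B ∘ δD ◇ B) ∘ ◇₁ (εB (◇ ∷ B)))
      ≈⟨ ≈-trans (refl⟩∘⟨ assocʳ) (cancelˡ (εB-δB ◇ B)) ⟩
    δD ◇ B ∘ ◇₁ (εB (◇ ∷ B))
      ≈⟨ ◇□-Absorbing⇒δD-cross h (εB (◇ ∷ B)) ⟩
    counit (◇ ∷ B)
      ≈⟨ 𝟏-♭ ⟨
    𝟏 _ ♭ ∎)

  □◇-Absorbing⇒Absorbing : □◇-Absorbing → Absorbing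
  □◇-Absorbing⇒Absorbing h =
    □◇-Absorbing⇒□-Absorbing h , ◇□-Absorbing⇒◇-Absorbing (□◇-Absorbing⇒◇□-Absorbing h)

  ◇□-Absorbing⇒Absorbing : ◇□-Absorbing → Absorbing
  ◇□-Absorbing⇒Absorbing h =
    □◇-Absorbing⇒□-Absorbing (◇□-Absorbing⇒□◇-Absorbing h) , ◇□-Absorbing⇒◇-Absorbing h

module _ where
  open Equational

  absorbing : (i : Fin 6) → Absorbing i
  absorbing i@zero =
    □◇-Absorbing⇒Absorbing i (λ A → PE₁⇒□-Absorbing i (λ A → pe1 A refl) ◇ A)
  absorbing i@(suc zero) =
    □◇-Absorbing⇒Absorbing i (PE₂⇒□◇-Absorbing i (λ A → pe2 A refl))
  absorbing i@(suc (suc zero)) =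
    ◇□-Absorbing⇒Absorbing i (λ A → PE₆⇒◇-Absorbing i (PE₃⇒PE₆ i (λ A → pe3 A refl)) □ A)
  absorbing i@(suc (suc (suc zero))) =
    □◇-Absorbing⇒Absorbing i (λ A → PE₁⇒□-Absorbing i (PE₄⇒PE₁ i (λ A → pe4 A refl)) ◇ A)
  absorbing i@(suc (suc (suc (suc zero)))) =
    ◇□-Absorbing⇒Absorbing i (PE₅⇒◇□-Absorbing i (λ A → pe5 A refl))
  absorbing i@(suc (suc (suc (suc (suc zero))))) =
    ◇□-Absorbing⇒Absorbing i (λ A → PE₆⇒◇-Absorbing i (λ A → pe6 A refl) □ A)

pattern c□ = zero
pattern c∅ = suc zero
pattern c◇ = suc (suc zero)

opClass : Op → Fin 3
opClass □ = c□
opClass ◇ = c◇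

prefix : Op → Fin 3 → Fin 3
prefix M c□ = c□
prefix M c∅ = opClass M
prefix M c◇ = c◇

classOf : Modality → Fin 3
classOf [] = c∅
classOf (M ∷ A) = prefix M (classOf A)

classOf-canon : ∀ c → classOf (canon c) ≡ c
classOf-canon c□ = refl
classOf-canon c∅ = refl
classOf-canon c◇ = refl

prefix-absorbs : ∀ N M c → prefix N (prefix M c) ≡ prefix M c
prefix-absorbs N M c□ = refl
prefix-absorbs N □ c∅ = refl
prefix-absorbs N ◇ c∅ = refl
prefix-absorbs N M c◇ = refl

infix 4 _≼_
data _≼_ : Fin 3 → Fin 3 → Set where
  ≼-refl : ∀ {c} → c ≼ c
  □≼∅ : c□ ≼ c∅
  ∅≼◇ : c∅ ≼ c◇
  □≼◇ : c□ ≼ c◇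

≼-reflexive : ∀ {c c'} → c ≡ c' → c ≼ c'
≼-reflexive refl = ≼-refl

≼-trans : ∀ {a b c} → a ≼ b → b ≼ c → a ≼ c
≼-trans ≼-refl q = q
≼-trans □≼∅ ≼-refl = □≼∅
≼-trans □≼∅ ∅≼◇ = □≼◇
≼-trans ∅≼◇ ≼-refl = ∅≼◇
≼-trans □≼◇ ≼-refl = □≼◇

≼-antisym : ∀ {c c'} → c ≼ c' → c' ≼ c → c ≡ c'
≼-antisym ≼-refl _ = refl
≼-antisym □≼∅ ()
≼-antisym ∅≼◇ ()
≼-antisym □≼◇ ()

≼-irrelevant : ∀ {c c'} (p q : c ≼ c') → p ≡ q
≼-irrelevant ≼-refl ≼-refl = refl
≼-irrelevant □≼∅ □≼∅ = refl
≼-irrelevant ∅≼◇ ∅≼◇ = refl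
≼-irrelevant □≼◇ □≼◇ = refl

prefix-mono : ∀ M {c c'} → c ≼ c' → prefix M c ≼ prefix M c'
prefix-mono M ≼-refl = ≼-refl
prefix-mono □ □≼∅ = ≼-refl
prefix-mono ◇ □≼∅ = □≼◇
prefix-mono □ ∅≼◇ = □≼◇
prefix-mono ◇ ∅≼◇ = ≼-refl
prefix-mono M □≼◇ = □≼◇

εB-≼ : ∀ c → prefix □ c ≼ c
εB-≼ c□ = ≼-refl
εB-≼ c∅ = □≼∅
εB-≼ c◇ = ≼-refl

εD-≼ : ∀ c → c ≼ prefix ◇ c
εD-≼ c□ = ≼-refl
εD-≼ c∅ = ∅≼◇
εD-≼ c◇ = ≼-refl

classMap : {A B : Modality} → Term A B → classOf A ≼ classOf B
classMap (𝟏 A) = ≼-refl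
classMap (εB A) = εB-≼ (classOf A)
classMap (εD A) = εD-≼ (classOf A)
classMap (δB M A) = ≼-reflexive (sym (prefix-absorbs □ M (classOf A)))
classMap (δD M A) = ≼-reflexive (prefix-absorbs ◇ M (classOf A))
classMap (g ∘ f) = ≼-trans (classMap f) (classMap g)
classMap (fmap M f) = prefix-mono M (classMap f)

class-unique : ∀ {A} c → Term A (canon c) → Term (canon c) A → c ≡ classOf A
class-unique c to from = trans (sym (classOf-canon c)) (≼-antisym (classMap from) (classMap to))

canonArrow : ∀ {c c'} → c ≼ c' → Term (canon c) (canon c')
canonArrow ≼-refl = 𝟏 _
canonArrow □≼∅ = εB []
canonArrow ∅≼◇ = εD []
canonArrow □≼◇ = εD [] ∘ εB []

collapse : ∀ M c → Term (M ∷ canon c) (canon (prefix M c))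
collapse □ c□ = εB (□ ∷ [])
collapse □ c∅ = 𝟏 _
collapse □ c◇ = εB (◇ ∷ [])
collapse ◇ c□ = δD □ []
collapse ◇ c∅ = 𝟏 _
collapse ◇ c◇ = δD ◇ []

expand : ∀ M c → Term (canon (prefix M c)) (M ∷ canon c)
expand □ c□ = δB □ []
expand □ c∅ = 𝟏 _
expand □ c◇ = δB ◇ []
expand ◇ c□ = εD (□ ∷ [])
expand ◇ c∅ = 𝟏 _
expand ◇ c◇ = εD (◇ ∷ [])

toCanon : ∀ A → Term A (canon (classOf A))
toCanon [] = 𝟏 []
toCanon (M ∷ A) = collapse M (classOf A) ∘ fmap M (toCanon A)

fromCanon : ∀ A → Term (canon (classOf A)) A
fromCanon [] = 𝟏 []
fromCanon (M ∷ A) = fmap M (fromCanon A) ∘ expand M (classOf A)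

reduce : {A B : Modality} → Term A B → Term (canon (classOf A)) (canon (classOf B))
reduce {A} {B} f = toCanon B ∘ f ∘ fromCanon A

module Normalisation {i : Fin 6} (□-absorbing : Equational.□-Absorbing i)
                     (◇-absorbing : Equational.◇-Absorbing i) where
  open Equational i

  collapse-expand : ∀ M c → collapse M c ∘ expand M c ≈ 𝟏 (canon (prefix M c))
  collapse-expand □ c□ = εB-δB □ []
  collapse-expand □ c∅ = ∘-identityˡ
  collapse-expand □ c◇ = εB-δB ◇ []
  collapse-expand ◇ c□ = δD-εD □ []
  collapse-expand ◇ c∅ = ∘-identityˡ
  collapse-expand ◇ c◇ = δD-εD ◇ []

  -- The only direct use of the extra preordering equation.
  expand-collapse : ∀ M c → expand M c ∘ collapse M c ≈ 𝟏 (M ∷ canon c)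
  expand-collapse □ c□ = □-absorbing □ []
  expand-collapse □ c∅ = ∘-identityˡ
  expand-collapse □ c◇ = □-absorbing ◇ []
  expand-collapse ◇ c□ = ◇-absorbing □ []
  expand-collapse ◇ c∅ = ∘-identityˡ
  expand-collapse ◇ c◇ = ◇-absorbing ◇ []

  toCanon-fromCanon : ∀ A → toCanon A ∘ fromCanon A ≈ 𝟏 (canon (classOf A))
  toCanon-fromCanon [] = ∘-identityˡ
  toCanon-fromCanon (M ∷ A) =
    inverse-∘ (collapse-expand M (classOf A)) (fmap-inverse M (toCanon-fromCanon A))

  fromCanon-toCanon : ∀ A → fromCanon A ∘ toCanon A ≈ 𝟏 A
  fromCanon-toCanon [] = ∘-identityˡ
  fromCanon-toCanon (M ∷ A) =
    inverse-∘ (fmap-inverse M (fromCanon-toCanon A)) (expand-collapse M (classOf A))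

  toCanon-fmap-fromCanon : ∀ M A → toCanon (M ∷ A) ∘ fmap M (fromCanon A) ≈ collapse M (classOf A)
  toCanon-fmap-fromCanon M A = cancelʳ (fmap-inverse M (toCanon-fromCanon A))

  reduce-injective : {f g : Term A B} → reduce f ≈ reduce g → f ≈ g
  reduce-injective {A} {B} {f} {g} e = begin
    f                                        ≈⟨ unreduce f ⟨
    fromCanon B ∘ reduce f ∘ toCanon A       ≈⟨ refl⟩∘⟨ e ⟩∘⟨refl ⟩
    fromCanon B ∘ reduce g ∘ toCanon A       ≈⟨ unreduce g ⟩
    g                                        ∎
    where
    unreduce : (h : Term A B) → fromCanon B ∘ reduce h ∘ toCanon A ≈ h
    unreduce h = begin
      fromCanon B ∘ reduce h ∘ toCanon A       ≈⟨ assocˡ ⟩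
      (fromCanon B ∘ reduce h) ∘ toCanon A     ≈⟨ cancelˡ (fromCanon-toCanon B) ⟩∘⟨refl ⟩
      (h ∘ fromCanon A) ∘ toCanon A            ≈⟨ cancelʳ (fromCanon-toCanon A) ⟩
      h                                        ∎

  reduce-∘ : (f : Term A B) (g : Term B C) → reduce (g ∘ f) ≈ reduce g ∘ reduce f
  reduce-∘ {A} {B} {C} f g = begin
    toCanon C ∘ (g ∘ f) ∘ fromCanon A
      ≈⟨ refl⟩∘⟨ assocʳ ⟩
    toCanon C ∘ g ∘ f ∘ fromCanon A
      ≈⟨ refl⟩∘⟨ refl⟩∘⟨ cancelˡ (fromCanon-toCanon B) ⟨
    toCanon C ∘ g ∘ fromCanon B ∘ toCanon B ∘ f ∘ fromCanon A
      ≈⟨ refl⟩∘⟨ assocˡ ⟩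
    toCanon C ∘ (g ∘ fromCanon B) ∘ reduce f
      ≈⟨ assocˡ ⟩
    reduce g ∘ reduce f ∎

  reduce-fmap : ∀ M (f : Term A B) →
                reduce (fmap M f)
                ≈ collapse M (classOf B) ∘ fmap M (reduce f) ∘ expand M (classOf A)
  reduce-fmap {A} {B} M f = begin
    (collapse M b ∘ fmap M (toCanon B)) ∘ fmap M f ∘ fmap M (fromCanon A) ∘ expand M a
      ≈⟨ assocʳ ⟩
    collapse M b ∘ fmap M (toCanon B) ∘ fmap M f ∘ fmap M (fromCanon A) ∘ expand M a
      ≈⟨ refl⟩∘⟨ refl⟩∘⟨ assocˡ ⟩
    collapse M b ∘ fmap M (toCanon B) ∘ (fmap M f ∘ fmap M (fromCanon A)) ∘ expand M a
      ≈⟨ refl⟩∘⟨ assocˡ ⟩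
    collapse M b ∘ (fmap M (toCanon B) ∘ (fmap M f ∘ fmap M (fromCanon A))) ∘ expand M a
      ≈⟨ refl⟩∘⟨ ≈-trans (fmap-homo M) (refl⟩∘⟨ fmap-homo M) ⟩∘⟨refl ⟨
    collapse M b ∘ fmap M (reduce f) ∘ expand M a
      ∎
    where
    a = classOf A
    b = classOf B

  reduce-εB : ∀ A → reduce (εB A) ≈ εB (canon (classOf A)) ∘ expand □ (classOf A)
  reduce-εB A = begin
    toCanon A ∘ εB A ∘ □₁ (fromCanon A) ∘ e
      ≈⟨ refl⟩∘⟨ assocˡ ⟩
    toCanon A ∘ (εB A ∘ □₁ (fromCanon A)) ∘ e
      ≈⟨ refl⟩∘⟨ nat-εB (fromCanon A) ⟩∘⟨refl ⟩
    toCanon A ∘ (fromCanon A ∘ εB (canon (classOf A))) ∘ e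
      ≈⟨ refl⟩∘⟨ assocʳ ⟩
    toCanon A ∘ fromCanon A ∘ εB (canon (classOf A)) ∘ e
      ≈⟨ cancelˡ (toCanon-fromCanon A) ⟩
    εB (canon (classOf A)) ∘ e ∎
    where
    e = expand □ (classOf A)

  reduce-εD : ∀ A → reduce (εD A) ≈ collapse ◇ (classOf A) ∘ εD (canon (classOf A))
  reduce-εD A = begin
    (c ∘ ◇₁ (toCanon A)) ∘ εD A ∘ fromCanon A
      ≈⟨ assocʳ ⟩
    c ∘ ◇₁ (toCanon A) ∘ εD A ∘ fromCanon A
      ≈⟨ refl⟩∘⟨ assocˡ ⟩
    c ∘ (◇₁ (toCanon A) ∘ εD A) ∘ fromCanon A
      ≈⟨ refl⟩∘⟨ nat-εD (toCanon A) ⟩∘⟨refl ⟩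
    c ∘ (εD (canon (classOf A)) ∘ toCanon A) ∘ fromCanon A
      ≈⟨ refl⟩∘⟨ cancelʳ (toCanon-fromCanon A) ⟩
    c ∘ εD (canon (classOf A)) ∎
    where
    c = collapse ◇ (classOf A)

  reduce-δB : ∀ M A → let a = classOf A in
              reduce (δB M A) ≈ collapse □ (prefix M a) ∘ □₁ (collapse M a) ∘ δB M (canon a) ∘ expand M a
  reduce-δB M A = begin
    (c ∘ □₁ t) ∘ δB M A ∘ fmap M f ∘ e
      ≈⟨ assocʳ ⟩
    c ∘ □₁ t ∘ δB M A ∘ fmap M f ∘ e
      ≈⟨ refl⟩∘⟨ refl⟩∘⟨ assocˡ ⟩
    c ∘ □₁ t ∘ (δB M A ∘ fmap M f) ∘ e
      ≈⟨ refl⟩∘⟨ refl⟩∘⟨ nat-δB M f ⟩∘⟨refl ⟨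
    c ∘ □₁ t ∘ (□₁ (fmap M f) ∘ δB M (canon a)) ∘ e
      ≈⟨ refl⟩∘⟨ ≈-trans (refl⟩∘⟨ assocʳ) assocˡ ⟩
    c ∘ (□₁ t ∘ □₁ (fmap M f)) ∘ δB M (canon a) ∘ e
      ≈⟨ refl⟩∘⟨ fmap-homo □ ⟩∘⟨refl ⟨
    c ∘ □₁ (t ∘ fmap M f) ∘ δB M (canon a) ∘ e
      ≈⟨ refl⟩∘⟨ fmap-cong □ (toCanon-fmap-fromCanon M A) ⟩∘⟨refl ⟩
    c ∘ □₁ (collapse M a) ∘ δB M (canon a) ∘ e ∎
    where
    a = classOf A
    c = collapse □ (prefix M a)
    t = toCanon (M ∷ A)
    f = fromCanon A
    e = expand M a

  reduce-δD : ∀ M A → let a = classOf A in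
              reduce (δD M A) ≈ collapse M a ∘ δD M (canon a) ∘ ◇₁ (expand M a) ∘ expand ◇ (prefix M a)
  reduce-δD M A = begin
    t ∘ δD M A ∘ ◇₁ (fmap M f ∘ e) ∘ e′
      ≈⟨ refl⟩∘⟨ refl⟩∘⟨ fmap-homo ◇ ⟩∘⟨refl ⟩
    t ∘ δD M A ∘ (◇₁ (fmap M f) ∘ ◇₁ e) ∘ e′
      ≈⟨ refl⟩∘⟨ ≈-trans (refl⟩∘⟨ assocʳ) assocˡ ⟩
    t ∘ (δD M A ∘ ◇₁ (fmap M f)) ∘ ◇₁ e ∘ e′
      ≈⟨ refl⟩∘⟨ nat-δD M f ⟩∘⟨refl ⟩
    t ∘ (fmap M f ∘ δD M (canon a)) ∘ ◇₁ e ∘ e′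
      ≈⟨ ≈-trans (refl⟩∘⟨ assocʳ) assocˡ ⟩
    (t ∘ fmap M f) ∘ δD M (canon a) ∘ ◇₁ e ∘ e′
      ≈⟨ toCanon-fmap-fromCanon M A ⟩∘⟨refl ⟩
    collapse M a ∘ δD M (canon a) ∘ ◇₁ e ∘ e′ ∎
    where
    a = classOf A
    t = toCanon (M ∷ A)
    f = fromCanon A
    e = expand M a
    e′ = expand ◇ (prefix M a)

  εB-canonical : ∀ c → εB (canon c) ∘ expand □ c ≈ canonArrow (εB-≼ c)
  εB-canonical c□ = εB-δB □ []
  εB-canonical c∅ = ∘-identityʳ
  εB-canonical c◇ = εB-δB ◇ []

  εD-canonical : ∀ c → collapse ◇ c ∘ εD (canon c) ≈ canonArrow (εD-≼ c)
  εD-canonical c□ = δD-εD □ []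
  εD-canonical c∅ = ∘-identityˡ
  εD-canonical c◇ = δD-εD ◇ []

  δB-canonical : ∀ M c → collapse □ (prefix M c) ∘ □₁ (collapse M c) ∘ δB M (canon c) ∘ expand M c
                         ≈ canonArrow (≼-reflexive (sym (prefix-absorbs □ M c)))
  δB-canonical □ c□ = ≈-trans (refl⟩∘⟨ cancelˡ (□εB-δB (□ ∷ []))) (εB-δB □ [])
  δB-canonical □ c◇ = ≈-trans (refl⟩∘⟨ cancelˡ (□εB-δB (◇ ∷ []))) (εB-δB ◇ [])
  δB-canonical ◇ c□ = sandwich (□δD-δB □ []) (εB-δB □ []) (δD-εD □ [])
  δB-canonical ◇ c◇ = sandwich (□δD-δB ◇ []) (εB-δB ◇ []) (δD-εD ◇ [])
  δB-canonical □ c∅ =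
    ≈-trans (refl⟩∘⟨ ≈-trans (fmap-id □ _ ⟩∘⟨ ∘-identityʳ) ∘-identityˡ) (εB-δB □ [])
  δB-canonical ◇ c∅ =
    ≈-trans (refl⟩∘⟨ ≈-trans (fmap-id □ _ ⟩∘⟨ ∘-identityʳ) ∘-identityˡ) (εB-δB ◇ [])

  δD-canonical : ∀ M c → collapse M c ∘ δD M (canon c) ∘ ◇₁ (expand M c) ∘ expand ◇ (prefix M c)
                         ≈ canonArrow (≼-reflexive (prefix-absorbs ◇ M c))
  δD-canonical □ c□ = sandwich (δD-◇δB □ []) (εB-δB □ []) (δD-εD □ [])
  δD-canonical □ c◇ = sandwich (δD-◇δB ◇ []) (εB-δB ◇ []) (δD-εD ◇ [])
  δD-canonical ◇ c□ = ≈-trans (refl⟩∘⟨ cancelˡ (δD-◇εD (□ ∷ []))) (δD-εD □ [])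
  δD-canonical ◇ c◇ = ≈-trans (refl⟩∘⟨ cancelˡ (δD-◇εD (◇ ∷ []))) (δD-εD ◇ [])
  δD-canonical □ c∅ =
    ≈-trans ∘-identityˡ (≈-trans (refl⟩∘⟨ ≈-trans (fmap-id ◇ _ ⟩∘⟨refl) ∘-identityˡ) (δD-εD □ []))
  δD-canonical ◇ c∅ =
    ≈-trans ∘-identityˡ (≈-trans (refl⟩∘⟨ ≈-trans (fmap-id ◇ _ ⟩∘⟨refl) ∘-identityˡ) (δD-εD ◇ []))

  collapse-conj : ∀ M {c c'} (p : c ≼ c') →
                  collapse M c' ∘ fmap M (canonArrow p) ∘ expand M c ≈ canonArrow (prefix-mono M p)
  collapse-conj M {c} ≼-refl =
    ≈-trans (refl⟩∘⟨ ≈-trans (fmap-id M _ ⟩∘⟨refl) ∘-identityˡ) (collapse-expand M c)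
  collapse-conj □ □≼∅ = ≈-trans ∘-identityˡ (□εB-δB [])
  collapse-conj ◇ □≼∅ = ≈-trans ∘-identityˡ (nat-εD (εB []))
  collapse-conj □ ∅≼◇ = ≈-trans (refl⟩∘⟨ ∘-identityʳ) (nat-εB (εD []))
  collapse-conj ◇ ∅≼◇ = ≈-trans (refl⟩∘⟨ ∘-identityʳ) (δD-◇εD [])
  collapse-conj □ □≼◇ = begin
    εB (◇ ∷ []) ∘ □₁ (εD [] ∘ εB []) ∘ δB □ []              ≈⟨ refl⟩∘⟨ fmap-homo □ ⟩∘⟨refl ⟩
    εB (◇ ∷ []) ∘ (□₁ (εD []) ∘ □₁ (εB [])) ∘ δB □ []       ≈⟨ refl⟩∘⟨ cancelʳ (□εB-δB []) ⟩
    εB (◇ ∷ []) ∘ □₁ (εD [])                                ≈⟨ nat-εB (εD []) ⟩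
    εD [] ∘ εB []                                           ∎
  collapse-conj ◇ □≼◇ = begin
    δD ◇ [] ∘ ◇₁ (εD [] ∘ εB []) ∘ εD (□ ∷ [])              ≈⟨ refl⟩∘⟨ fmap-homo ◇ ⟩∘⟨refl ⟩
    δD ◇ [] ∘ (◇₁ (εD []) ∘ ◇₁ (εB [])) ∘ εD (□ ∷ [])       ≈⟨ refl⟩∘⟨ assocʳ ⟩
    δD ◇ [] ∘ ◇₁ (εD []) ∘ ◇₁ (εB []) ∘ εD (□ ∷ [])         ≈⟨ cancelˡ (δD-◇εD []) ⟩
    ◇₁ (εB []) ∘ εD (□ ∷ [])                                ≈⟨ nat-εD (εB []) ⟩
    εD [] ∘ εB []                                           ∎

  canonArrow-trans : ∀ {a b c} (p : a ≼ b) (q : b ≼ c) →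
                     canonArrow (≼-trans p q) ≈ canonArrow q ∘ canonArrow p
  canonArrow-trans ≼-refl q = ≈-sym ∘-identityʳ
  canonArrow-trans □≼∅ ≼-refl = ≈-sym ∘-identityˡ
  canonArrow-trans □≼∅ ∅≼◇ = ≈-refl
  canonArrow-trans ∅≼◇ ≼-refl = ≈-sym ∘-identityˡ
  canonArrow-trans □≼◇ ≼-refl = ≈-sym ∘-identityˡ

  reduce-canonArrow : (f : Term A B) → reduce f ≈ canonArrow (classMap f)
  reduce-canonArrow (𝟏 A) = ≈-trans (refl⟩∘⟨ ∘-identityˡ) (toCanon-fromCanon A)
  reduce-canonArrow (εB A) = ≈-trans (reduce-εB A) (εB-canonical (classOf A))
  reduce-canonArrow (εD A) = ≈-trans (reduce-εD A) (εD-canonical (classOf A))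
  reduce-canonArrow (δB M A) = ≈-trans (reduce-δB M A) (δB-canonical M (classOf A))
  reduce-canonArrow (δD M A) = ≈-trans (reduce-δD M A) (δD-canonical M (classOf A))
  reduce-canonArrow (g ∘ f) = begin
    reduce (g ∘ f)
      ≈⟨ reduce-∘ f g ⟩
    reduce g ∘ reduce f
      ≈⟨ reduce-canonArrow g ⟩∘⟨ reduce-canonArrow f ⟩
    canonArrow (classMap g) ∘ canonArrow (classMap f)
      ≈⟨ canonArrow-trans (classMap f) (classMap g) ⟨
    canonArrow (classMap (g ∘ f)) ∎
  reduce-canonArrow (fmap M f) = begin
    reduce (fmap M f)
      ≈⟨ reduce-fmap M f ⟩
    collapse M _ ∘ fmap M (reduce f) ∘ expand M _
      ≈⟨ refl⟩∘⟨ fmap-cong M (reduce-canonArrow f) ⟩∘⟨refl ⟩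
    collapse M _ ∘ fmap M (canonArrow (classMap f)) ∘ expand M _
      ≈⟨ collapse-conj M (classMap f) ⟩
    canonArrow (classMap (fmap M f)) ∎

  preorder : (f g : Term A B) → f ≈ g
  preorder f g = reduce-injective (≈-trans reduce-f (≈-sym (reduce-canonArrow g)))
    where
    reduce-f : reduce f ≈ canonArrow (classMap g)
    reduce-f = subst (λ p → reduce f ≈ canonArrow p) (≼-irrelevant (classMap f) (classMap g))
                     (reduce-canonArrow f)

  canonIso : ∀ A → Iso i A (canon (classOf A))
  canonIso A = toCanon A , fromCanon A , fromCanon-toCanon A , toCanon-fromCanon A

mainTheorem9 : (i : Fin 6) →
    ((A B : Modality) (f g : Term A B) → i ⊢ f ≈ g)
    × ((A : Modality) → Σ (Fin 3) λ c → Iso i A (canon c)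
         × ((c' : Fin 3) → Iso i A (canon c') → c' ≡ c))
    × ((f : Term (□ ∷ []) (□ ∷ [])) → i ⊢ f ≈ 𝟏 (□ ∷ []))
    × ((f : Term [] []) → i ⊢ f ≈ 𝟏 [])
    × ((f : Term (◇ ∷ []) (◇ ∷ [])) → i ⊢ f ≈ 𝟏 (◇ ∷ []))
    × ((f : Term (□ ∷ []) []) → i ⊢ f ≈ εB [])
    × ((f : Term [] (◇ ∷ [])) → i ⊢ f ≈ εD [])
    × ((f : Term (□ ∷ []) (◇ ∷ [])) → i ⊢ f ≈ εD [] ∘ εB [])
    × (Term [] (□ ∷ []) → ⊥)
    × (Term (◇ ∷ []) [] → ⊥)
    × (Term (◇ ∷ []) (□ ∷ []) → ⊥)
mainTheorem9 i =
    (λ _ _ → preorder)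
  , (λ A → classOf A , canonIso A , λ { c (to , from , _) → class-unique c to from })
  , (λ f → preorder f _) , (λ f → preorder f _) , (λ f → preorder f _)
  , (λ f → preorder f _) , (λ f → preorder f _) , (λ f → preorder f _)
  , (λ f → case classMap f of λ ())
  , (λ f → case classMap f of λ ())
  , (λ f → case classMap f of λ ())
  where
  open Normalisation (proj₁ (absorbing i)) (proj₂ (absorbing i))
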